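{- Let $E$ be a finite set and $(E,\mathcal{F})$ an accessible set system with $\mathcal{F}\neq\emptyset$. Let $E_{\mathcal{F}}=\bigcup_{X\in\mathcal{F}}X$, and assume $\Gamma(X)\neq\emptyset$ for every $X\in\mathcal{F}\setminus\{E_{\mathcal{F}}\}$. Then the following are equivalent: (1) $(E,\mathcal{F})$ is an antimatroid; (2) for every monotone linkage function $\pi$, every run of the Chain Algorithm with operator $\Gamma$ returns a set $X^0\in\mathcal{F}$ with $F_\Gamma(X^0)\ge F_\Gamma(Y)$ for all $Y\in\mathcal{F}\setminus\{E_{\mathcal{F}}\}$.
   Context: A set system $(E,\mathcal{F})$, $\mathcal{F}\subseteq2^E$, is accessible if for each nonempty $X\in\mathcal{F}$ there is $x\in X$ with $X\setminus\{x\}\in\mathcal{F}$. It is an antimatroid if $\mathcal{F}\ne\emptyset$, it is accessible, and for all $X,Y\in\mathcal{F}$ with $X\not\subseteq Y$ there is $x\in X\setminus Y$ with $Y\cup\{x\}\in\mathcal{F}$. For $X\in\mathcal{F}$, $\Gamma(X)=\{x\in E\setminus X: X\cup\{x\}\in\mathcal{F}\}$. A monotone linkage function is $\pi:E\times2^E\to\mathbb{R}$ with $\pi(x,X)\ge\pi(x,Y)$ whenever $X\subseteq Y$. $F_\Gamma(X)=\min_{x\in\Gamma(X)}\pi(x,X)$ (with $\min\emptyset=+\infty$). Chain Algorithm with operator $\Gamma$: set $X^0=\emptyset$, $X=\emptyset$; while $\Gamma(X)\neq\emptyset$: if $F_\Gamma(X)>F_\Gamma(X^0)$ set $X^0=X$;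 choose any $x\in\Gamma(X)$ with $\pi(x,X)\le\pi(y,X)$ for all $y\in\Gamma(X)$; set $X=X\cup\{x\}$. Return $X^0$.
   Formalization: The monotone linkage functions π in clause (2) take values in ℚ instead of ℝ. -}

module Defs where

open import Data.Nat using (ℕ)
open import Data.Bool using (Bool; true; false; not; _∧_; if_then_else_; T)
open import Data.Fin using (Fin)
open import Data.Fin.Subset using (Subset; _∈_; _∉_; _⊆_; _⊈_; _∪_; _-_; ⁅_⁆; ⊥; Nonempty)
open import Data.Vec using (lookup; tabulate)
open import Data.List using (List; foldr; allFin)
open import Data.Rational using (ℚ; _≤_; _<_; _<?_; _⊓_)
open import Data.Product using (Σ; ∃; ∃-syntax; _×_; _,_)
open import Relation.Nullary.Decidable using (⌊_⌋)
open import Relation.Binary.PropositionalEquality using (_≡_; _≢_)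
open import Function.Bundles using (_⇔_)

-- The ground set E is Fin n; a set system F ⊆ 2^E is given by its
-- (Boolean) characteristic function on subsets.
SetSystem : ℕ → Set
SetSystem n = Subset n → Bool

module _ {n : ℕ} (F : SetSystem n) where

  InF : Subset n → Set
  InF X = T (F X)

  NonemptyFamily : Set
  NonemptyFamily = ∃[ X ] InF X

  Accessible : Set
  Accessible = ∀ X → InF X → Nonempty X → ∃[ x ] (x ∈ X × InF (X - x))

  Augmentation : Set
  Augmentation = ∀ X Y → InF X → InF Y → X ⊈ Y →
                 ∃[ x ] (x ∈ X × x ∉ Y × InF (Y ∪ ⁅ x ⁆))

  IsAntimatroid : Set
  IsAntimatroid = NonemptyFamily × Accessible × Augmentation

  IsUnionOfFamily : Subset n → Set
  IsUnionOfFamily U = ∀ x → (x ∈ U ⇔ (∃[ X ] (InF X × x ∈ X)))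

  inΓ : Subset n → Fin n → Bool
  inΓ X x = not (lookup X x) ∧ F (X ∪ ⁅ x ⁆)

  Γ : Subset n → Subset n
  Γ X = tabulate (inΓ X)

-- Rationals extended with +∞ (value of min over the empty set)
data ℚ∞ : Set where
  fin : ℚ → ℚ∞
  ∞   : ℚ∞

infix 4 _≤∞_
data _≤∞_ : ℚ∞ → ℚ∞ → Set where
  fin≤fin : ∀ {p q} → p ≤ q → fin p ≤∞ fin q
  _≤∞∞    : ∀ a → a ≤∞ ∞

min∞ : ℚ∞ → ℚ∞ → ℚ∞
min∞ (fin p) (fin q) = fin (p ⊓ q)
min∞ (fin p) ∞       = fin p
min∞ ∞       b       = b

_<∞ᵇ_ : ℚ∞ → ℚ∞ → Bool
fin p <∞ᵇ fin q = ⌊ p <? q ⌋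
fin p <∞ᵇ ∞     = true
∞     <∞ᵇ _     = false

Linkage : ℕ → Set
Linkage n = Fin n → Subset n → ℚ

Monotone : ∀ {n} → Linkage n → Set
Monotone π = ∀ x X Y → X ⊆ Y → π x Y ≤ π x X

module _ {n : ℕ} (F : SetSystem n) (π : Linkage n) where

  FΓ : Subset n → ℚ∞
  FΓ X = foldr (λ x acc → if inΓ F X x then min∞ (fin (π x X)) acc else acc)
               ∞ (allFin n)

  -- ChainRun X X⁰ R : starting the while-loop in state (X, X⁰), some run of
  -- the Chain Algorithm (with arbitrary choice among minimisers) returns R.
  data ChainRun (X X⁰ : Subset n) : Subset n → Set where
    stop : (∀ y → y ∉ Γ F X) → ChainRun X X⁰ X⁰
    step : ∀ {R} (x : Fin n) →
           x ∈ Γ F X →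
           (∀ y → y ∈ Γ F X → π x X ≤ π y X) →
           ChainRun (X ∪ ⁅ x ⁆) (if FΓ X⁰ <∞ᵇ FΓ X then X else X⁰) R →
           ChainRun X X⁰ R

  ChainAlgorithmOptimal : Subset n → Set
  ChainAlgorithmOptimal EF =
    ∀ R → ChainRun ⊥ ⊥ R →
      InF F R × (∀ Y → InF F Y → Y ≢ EF → FΓ Y ≤∞ FΓ R)

{-# OPTIONS --safe #-}
module Submission where

open import Defs
open import Data.Nat using (ℕ)
open import Data.Fin.Subset using (Subset; Nonempty)
open import Relation.Binary.PropositionalEquality using (_≢_)
open import Function.Bundles using (_⇔_)

-- (1) ⇒ (2). Along a run, every Y ∈ 𝓕 other than E_𝓕 that contains the current
-- set S satisfies F_Γ(Y) ≤ F_Γ(returned set). When the greedy step S → S ∪ {e}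
-- leaves Y, augmentation of Y from S ∪ {e} can only add e, so by monotonicity
-- F_Γ(Y) ≤ π(e,Y) ≤ π(e,S) = F_Γ(S), and the value of X⁰ never decreases.
--
-- (2) ⇒ (1). Augmentation from X is proved along an accessible ordering of X,
-- removing some x with X - x ∈ 𝓕. For Y ∌ x, run the algorithm on the linkage
-- that costs 0 on X, 0 everywhere once x has been chosen, and 1 otherwise.
-- Augmentation from X - x keeps the run inside X until it picks x, so every
-- candidate X⁰ has value 0; if no element of X augmented Y, then F_Γ(Y) = 1,
-- contradicting optimality.

open import Data.Nat.Base using (_<_; _∸_)
open import Data.Nat.Properties using (∸-monoʳ-<)
open import Data.Nat.Induction using (<-wellFounded)
open import Data.Bool.Base using (true; false; not; _∨_; if_then_else_; T)
open import Data.Bool.Properties using (T-≡; T-∧; T-not-≡; ¬-not; ∨-zeroʳ)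
open import Data.Fin.Base using (Fin)
open import Data.Fin.Properties using (_≟_; any?)
open import Data.Fin.Subset using (_∈_; _∉_; _⊆_; _⊈_; _∪_; _-_; ⁅_⁆; ∣_∣; Empty)
  renaming (⊥ to ∅)
open import Data.Fin.Subset.Properties
  using (_∈?_; _⊆?_; nonempty?; Empty-unique; ∉⊥; ⊆-min; ⊆-refl; ⊆-trans; ⊆-antisym;
         x∈⁅x⁆; x∈⁅y⁆⇒x≡y; x∈p∪q⁺; x∈p∪q⁻; p⊆p∪q; p─q⊆p; x∈p∧x≢y⇒x∈p-y;
         ∣p∣≤n; p⊂q⇒∣p∣<∣q∣; x∈p⇒∣p-x∣<∣p∣)
open import Data.Vec.Base using (lookup)
open import Data.Vec.Properties using (lookup∘tabulate; []=⇒lookup; lookup⇒[]=)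
open import Data.List.Base using (List; []; _∷_; foldr; filter; allFin)
open import Data.List.Relation.Unary.Any using (here; there)
import Data.List.Relation.Unary.All as All
open import Data.List.Relation.Unary.All.Properties using (all-filter)
import Data.List.Membership.Propositional as List
open import Data.List.Membership.Propositional.Properties using (∈-allFin; ∈-filter⁺)
open import Data.Rational.Base using (ℚ; 0ℚ; 1ℚ; _≤_; _⊓_)
open import Data.Rational.Properties
  using (_≤?_; _<?_; ≤-refl; ≤-reflexive; ≤-trans; <⇒≤; ≮⇒≥; p⊓q≤p; p⊓q≤q; ⊓-glb; ≤-decTotalOrder)
open import Data.Product.Base using (∃-syntax; _×_; _,_; proj₁; proj₂)
open import Data.Sum.Base using (_⊎_; inj₁; inj₂)
open import Data.Empty using (⊥-elim)
open import Function.Base using (_∘_; _on_)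
open import Function.Bundles using (mk⇔; Equivalence)
open import Induction.WellFounded using (Acc; acc)
open import Relation.Binary.Bundles using (Preorder; DecTotalOrder)
open import Relation.Binary.Structures using (IsPreorder)
import Relation.Binary.Construct.On as On
import Relation.Binary.Reasoning.Preorder as PreorderReasoning
open import Relation.Binary.PropositionalEquality
  using (_≡_; refl; sym; trans; subst; isEquivalence)
open import Relation.Nullary using (¬_; yes; no)
open import Relation.Nullary.Decidable using (from-yes; from-no; _×-dec_)
open import Data.List.Extrema (DecTotalOrder.totalOrder ≤-decTotalOrder)
  using (argmin; argmin-all; f[argmin]≤f[xs])

open Equivalence using (to; from)

1≰0 : ¬ 1ℚ ≤ 0ℚ
1≰0 = from-no (1ℚ ≤? 0ℚ)

fin-≤∞⁻ : ∀ {p q} → fin p ≤∞ fin q → p ≤ q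
fin-≤∞⁻ (fin≤fin p≤q) = p≤q

≤∞-refl : ∀ {a} → a ≤∞ a
≤∞-refl {fin p} = fin≤fin ≤-refl
≤∞-refl {∞}     = ∞ ≤∞∞

≤∞-trans : ∀ {a b c} → a ≤∞ b → b ≤∞ c → a ≤∞ c
≤∞-trans (fin≤fin p≤q) (fin≤fin q≤r) = fin≤fin (≤-trans p≤q q≤r)
≤∞-trans _             (_ ≤∞∞)       = _ ≤∞∞

≤∞-isPreorder : IsPreorder _≡_ _≤∞_
≤∞-isPreorder = record
  { isEquivalence = isEquivalence
  ; reflexive     = λ { refl → ≤∞-refl }
  ; trans         = ≤∞-trans
  }

≤∞-preorder : Preorder _ _ _
≤∞-preorder = record { isPreorder = ≤∞-isPreorder }

module ≤∞-Reasoning = PreorderReasoning ≤∞-preorder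

min∞-≤ˡ : ∀ a b → min∞ a b ≤∞ a
min∞-≤ˡ (fin p) (fin q) = fin≤fin (p⊓q≤p p q)
min∞-≤ˡ (fin p) ∞       = ≤∞-refl
min∞-≤ˡ ∞       b       = b ≤∞∞

min∞-≤ʳ : ∀ a b → min∞ a b ≤∞ b
min∞-≤ʳ (fin p) (fin q) = fin≤fin (p⊓q≤q p q)
min∞-≤ʳ (fin p) ∞       = fin p ≤∞∞
min∞-≤ʳ ∞       b       = ≤∞-refl

min∞-greatest : ∀ {a b c} → c ≤∞ a → c ≤∞ b → c ≤∞ min∞ a b
min∞-greatest (fin≤fin r≤p) (fin≤fin r≤q) = fin≤fin (⊓-glb r≤p r≤q)
min∞-greatest (fin≤fin r≤p) (_ ≤∞∞)       = fin≤fin r≤p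
min∞-greatest (_ ≤∞∞)       c≤b           = c≤b

<∞ᵇ⇒≤∞ : ∀ a b → (a <∞ᵇ b) ≡ true → a ≤∞ b
<∞ᵇ⇒≤∞ (fin p) (fin q) _ with p <? q
... | yes p<q = fin≤fin (<⇒≤ p<q)
<∞ᵇ⇒≤∞ (fin p) ∞       _ = fin p ≤∞∞

≮∞ᵇ⇒≥∞ : ∀ a b → (a <∞ᵇ b) ≡ false → b ≤∞ a
≮∞ᵇ⇒≥∞ (fin p) (fin q) _ with p <? q
... | no p≮q = fin≤fin (≮⇒≥ p≮q)
≮∞ᵇ⇒≥∞ ∞       b       _ = b ≤∞∞

argmax∞ : {A : Set} → (A → ℚ∞) → A → A → A
argmax∞ f a b = if f a <∞ᵇ f b then b else a

module _ {A : Set} (f : A → ℚ∞) (a b : A) where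

  argmax∞-≥ : f a ≤∞ f (argmax∞ f a b) × f b ≤∞ f (argmax∞ f a b)
  argmax∞-≥ with f a <∞ᵇ f b in eq
  ... | true  = <∞ᵇ⇒≤∞ (f a) (f b) eq , ≤∞-refl
  ... | false = ≤∞-refl , ≮∞ᵇ⇒≥∞ (f a) (f b) eq

  argmax∞-sel : (P : A → Set) → P a → P b → P (argmax∞ f a b)
  argmax∞-sel P pa pb with f a <∞ᵇ f b
  ... | true  = pb
  ... | false = pa

module _ {n : ℕ} where

  ∉⇒lookup≡false : ∀ {x : Fin n} {p} → x ∉ p → lookup p x ≡ false
  ∉⇒lookup≡false {x} {p} x∉p = ¬-not (x∉p ∘ lookup⇒[]= x p)

  ∪⁅⁆-least : ∀ {p q : Subset n} {y} → p ⊆ q → y ∈ q → p ∪ ⁅ y ⁆ ⊆ q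
  ∪⁅⁆-least {p} {y = y} p⊆q y∈q x∈p∪y with x∈p∪q⁻ p ⁅ y ⁆ x∈p∪y
  ... | inj₁ x∈p = p⊆q x∈p
  ... | inj₂ x∈y rewrite x∈⁅y⁆⇒x≡y y x∈y = y∈q

  p-x⊆q⇒p⊆q∪⁅x⁆ : ∀ {p q : Subset n} {x} → p - x ⊆ q → p ⊆ q ∪ ⁅ x ⁆
  p-x⊆q⇒p⊆q∪⁅x⁆ {x = x} p-x⊆q {y} y∈p with y ≟ x
  ... | yes refl = x∈p∪q⁺ (inj₂ (x∈⁅x⁆ x))
  ... | no y≢x   = x∈p∪q⁺ (inj₁ (p-x⊆q (x∈p∧x≢y⇒x∈p-y y∈p y≢x)))

  ∣p∣<∣p∪⁅x⁆∣ : ∀ {p : Subset n} {x} → x ∉ p → ∣ p ∣ < ∣ p ∪ ⁅ x ⁆ ∣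
  ∣p∣<∣p∪⁅x⁆∣ {x = x} x∉p = p⊂q⇒∣p∣<∣q∣ (p⊆p∪q ⁅ x ⁆ , x , x∈p∪q⁺ (inj₂ (x∈⁅x⁆ x)) , x∉p)

module _ {n : ℕ} (F : SetSystem n) where

  ∈Γ⇒inΓ : ∀ {X y} → y ∈ Γ F X → inΓ F X y ≡ true
  ∈Γ⇒inΓ {X} {y} y∈ΓX = subst (_≡ true) (lookup∘tabulate (inΓ F X) y) ([]=⇒lookup y∈ΓX)

  inΓ⇒∈Γ : ∀ {X y} → inΓ F X y ≡ true → y ∈ Γ F X
  inΓ⇒∈Γ {X} {y} eq = lookup⇒[]= y (Γ F X) (subst (_≡ true) (sym (lookup∘tabulate (inΓ F X) y)) eq)

  ∈Γ⁻ : ∀ {X y} → y ∈ Γ F X → y ∉ X × InF F (X ∪ ⁅ y ⁆)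
  ∈Γ⁻ {X} {y} y∈ΓX with to T-∧ (from T-≡ (∈Γ⇒inΓ y∈ΓX))
  ... | y∉X , X∪y∈F = (λ y∈X → subst (T ∘ not) ([]=⇒lookup y∈X) y∉X) , X∪y∈F

  ∈Γ⁺ : ∀ {X y} → y ∉ X → InF F (X ∪ ⁅ y ⁆) → y ∈ Γ F X
  ∈Γ⁺ y∉X X∪y∈F = inΓ⇒∈Γ (to T-≡ (from T-∧ (from T-not-≡ (∉⇒lookup≡false y∉X) , X∪y∈F)))

  module _ (accessible : Accessible F) (P : Subset n → Set)
           (base : ∀ X → InF F X → Empty X → P X)
           (step : ∀ X x → InF F X → x ∈ X → P (X - x) → P X) where

    accessible-induction : ∀ X → InF F X → P X
    accessible-induction X X∈F = go X X∈F (On.wellFounded ∣_∣ <-wellFounded X)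
      where
      go : ∀ X → InF F X → Acc (_<_ on ∣_∣) X → P X
      go X X∈F (acc smaller) with nonempty? X
      ... | no empty = base X X∈F empty
      ... | yes nonempty with accessible X X∈F nonempty
      ...   | x , x∈X , X-x∈F = step X x X∈F x∈X (go (X - x) X-x∈F (smaller (x∈p⇒∣p-x∣<∣p∣ x∈X)))

  ∅∈F : Accessible F → NonemptyFamily F → InF F ∅
  ∅∈F accessible (X , X∈F) =
    accessible-induction accessible (λ _ → InF F ∅)
      (λ X X∈F empty → subst (InF F) (Empty-unique empty) X∈F)
      (λ _ _ _ _ ∅∈F → ∅∈F)
      X X∈F

  module _ {EF : Subset n} (EF-union : IsUnionOfFamily F EF) where

    ⊆EF : ∀ {Y} → InF F Y → Y ⊆ EF
    ⊆EF Y∈F y∈Y = from (EF-union _) (_ , Y∈F , y∈Y)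

  module _ (π : Linkage n) where

    IsGreedyChoice : Subset n → Fin n → Set
    IsGreedyChoice S e = e ∈ Γ F S × (∀ y → y ∈ Γ F S → π e S ≤ π y S)

    private
      minΓ : Subset n → List (Fin n) → ℚ∞
      minΓ X = foldr (λ x acc → if inΓ F X x then min∞ (fin (π x X)) acc else acc) ∞

      minΓ≤π : ∀ X {y} xs → y List.∈ xs → inΓ F X y ≡ true → minΓ X xs ≤∞ fin (π y X)
      minΓ≤π X (x ∷ xs) (here refl) y∈ΓX rewrite y∈ΓX = min∞-≤ˡ (fin (π x X)) (minΓ X xs)
      minΓ≤π X (x ∷ xs) (there y∈xs) y∈ΓX with inΓ F X x
      ... | true  = ≤∞-trans (min∞-≤ʳ (fin (π x X)) (minΓ X xs)) (minΓ≤π X xs y∈xs y∈ΓX)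
      ... | false = minΓ≤π X xs y∈xs y∈ΓX

      minΓ-greatest : ∀ X {q} xs → (∀ y → inΓ F X y ≡ true → q ≤ π y X) → fin q ≤∞ minΓ X xs
      minΓ-greatest X []       q≤Γ = _ ≤∞∞
      minΓ-greatest X (x ∷ xs) q≤Γ with inΓ F X x in x∈ΓX
      ... | true  = min∞-greatest (fin≤fin (q≤Γ x x∈ΓX)) (minΓ-greatest X xs q≤Γ)
      ... | false = minΓ-greatest X xs q≤Γ

    FΓ≤π : ∀ {X y} → y ∈ Γ F X → FΓ F π X ≤∞ fin (π y X)
    FΓ≤π {X} {y} y∈ΓX = minΓ≤π X (allFin n) (∈-allFin y) (∈Γ⇒inΓ y∈ΓX)

    FΓ-greatest : ∀ {X} q → (∀ y → y ∈ Γ F X → q ≤ π y X) → fin q ≤∞ FΓ F π X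
    FΓ-greatest {X} q q≤Γ = minΓ-greatest X (allFin n) (λ y → q≤Γ y ∘ inΓ⇒∈Γ)

    greedyChoice : ∀ S → Nonempty (Γ F S) → ∃[ e ] IsGreedyChoice S e
    greedyChoice S (y , y∈ΓS) =
      e , argmin-all πS y∈ΓS (all-filter (_∈? Γ F S) (allFin n)) , e-min
      where
      πS : Fin n → ℚ
      πS z = π z S
      candidates : List (Fin n)
      candidates = filter (_∈? Γ F S) (allFin n)
      e : Fin n
      e = argmin πS y candidates
      e-min : ∀ z → z ∈ Γ F S → π e S ≤ π z S
      e-min z z∈ΓS =
        All.lookup (f[argmin]≤f[xs] y candidates) (∈-filter⁺ (_∈? Γ F S) (∈-allFin z) z∈ΓS)

    chainRun-exists : ∀ S X⁰ → ∃[ R ] ChainRun F π S X⁰ R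
    chainRun-exists S X⁰ = go S X⁰ (On.wellFounded (λ S → n ∸ ∣ S ∣) <-wellFounded S)
      where
      go : ∀ S X⁰ → Acc (_<_ on λ S → n ∸ ∣ S ∣) S → ∃[ R ] ChainRun F π S X⁰ R
      go S X⁰ (acc larger) with nonempty? (Γ F S)
      ... | no Γ-empty = X⁰ , stop (λ y y∈ΓS → Γ-empty (y , y∈ΓS))
      ... | yes Γ-nonempty with greedyChoice S Γ-nonempty
      ...   | e , e∈ΓS , e-min with go (S ∪ ⁅ e ⁆) (argmax∞ (FΓ F π) X⁰ S) (larger grows)
        where
        grows : n ∸ ∣ S ∪ ⁅ e ⁆ ∣ < n ∸ ∣ S ∣
        grows = ∸-monoʳ-< (∣p∣<∣p∪⁅x⁆∣ (proj₁ (∈Γ⁻ e∈ΓS))) (∣p∣≤n (S ∪ ⁅ e ⁆))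
      ...     | R , run = R , step e e∈ΓS e-min run

    chainRun-induction : (Q P : Subset n → Set) →
                         (∀ {S e} → Q S → IsGreedyChoice S e → Q (S ∪ ⁅ e ⁆) × P S) →
                         ∀ {S X⁰ R} → ChainRun F π S X⁰ R → Q S → P X⁰ → P R
    chainRun-induction Q P preserved (stop _) _ PX⁰ = PX⁰
    chainRun-induction Q P preserved {S} {X⁰} (step e e∈ΓS e-min run) QS PX⁰
      with preserved QS (e∈ΓS , e-min)
    ... | QS∪e , PS = chainRun-induction Q P preserved run QS∪e
                        (argmax∞-sel (FΓ F π) X⁰ S P PX⁰ PS)

    chainRun-≥ : ∀ {S X⁰ R} → ChainRun F π S X⁰ R → FΓ F π X⁰ ≤∞ FΓ F π R
    chainRun-≥ (stop _) = ≤∞-refl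
    chainRun-≥ {S} {X⁰} (step _ _ _ run) =
      ≤∞-trans (proj₁ (argmax∞-≥ (FΓ F π) X⁰ S)) (chainRun-≥ run)

module _ {n : ℕ} {F : SetSystem n} {EF : Subset n} (EF-union : IsUnionOfFamily F EF)
         (Γ-nonempty : ∀ X → InF F X → X ≢ EF → Nonempty (Γ F X)) where

  module _ (augmentation : Augmentation F) {π : Linkage n} (monotone : Monotone π) where

    open ≤∞-Reasoning

    greedyStep-leaving : ∀ {S e Y} → IsGreedyChoice F π S e → InF F Y → S ⊆ Y → S ∪ ⁅ e ⁆ ⊈ Y →
                         FΓ F π Y ≤∞ FΓ F π S
    greedyStep-leaving {S} {e} {Y} (e∈ΓS , e-min) Y∈F S⊆Y S∪e⊈Y
      with augmentation (S ∪ ⁅ e ⁆) Y (proj₂ (∈Γ⁻ F e∈ΓS)) Y∈F S∪e⊈Y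
    ... | z , z∈S∪e , z∉Y , Y∪z∈F = begin
      FΓ F π Y    ≲⟨ FΓ≤π F π e∈ΓY ⟩
      fin (π e Y) ≲⟨ fin≤fin (monotone e S Y S⊆Y) ⟩
      fin (π e S) ≲⟨ FΓ-greatest F π (π e S) e-min ⟩
      FΓ F π S    ∎
      where
      z≡e : z ≡ e
      z≡e with x∈p∪q⁻ S ⁅ e ⁆ z∈S∪e
      ... | inj₁ z∈S = ⊥-elim (z∉Y (S⊆Y z∈S))
      ... | inj₂ z∈e = x∈⁅y⁆⇒x≡y e z∈e
      e∈ΓY : e ∈ Γ F Y
      e∈ΓY = subst (_∈ Γ F Y) z≡e (∈Γ⁺ F z∉Y Y∪z∈F)

    chainRun-optimal : ∀ {S X⁰ R} → ChainRun F π S X⁰ R → InF F S →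
                       ∀ Y → InF F Y → Y ≢ EF → S ⊆ Y → FΓ F π Y ≤∞ FΓ F π R
    chainRun-optimal {S} (stop Γ-empty) S∈F Y Y∈F Y≢EF S⊆Y
      with Γ-nonempty S S∈F (λ { refl → Y≢EF (⊆-antisym (⊆EF F EF-union Y∈F) S⊆Y) })
    ... | y , y∈ΓS = ⊥-elim (Γ-empty y y∈ΓS)
    chainRun-optimal {S} {X⁰} {R} (step e e∈ΓS e-min run) S∈F Y Y∈F Y≢EF S⊆Y
      with S ∪ ⁅ e ⁆ ⊆? Y
    ... | yes S∪e⊆Y = chainRun-optimal run (proj₂ (∈Γ⁻ F e∈ΓS)) Y Y∈F Y≢EF S∪e⊆Y
    ... | no S∪e⊈Y = begin
      FΓ F π Y                     ≲⟨ greedyStep-leaving (e∈ΓS , e-min) Y∈F S⊆Y S∪e⊈Y ⟩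
      FΓ F π S                     ≲⟨ proj₂ (argmax∞-≥ (FΓ F π) X⁰ S) ⟩
      FΓ F π (argmax∞ (FΓ F π) X⁰ S) ≲⟨ chainRun-≥ F π run ⟩
      FΓ F π R                     ∎

  antimatroid⇒chainOptimal : IsAntimatroid F → ∀ π → Monotone π → ChainAlgorithmOptimal F π EF
  antimatroid⇒chainOptimal (nonempty , accessible , augmentation) π monotone R run =
    chainRun-induction F π (InF F) (InF F)
      (λ S∈F (e∈ΓS , _) → proj₂ (∈Γ⁻ F e∈ΓS) , S∈F) run F∋∅ F∋∅ ,
    λ Y Y∈F Y≢EF → chainRun-optimal augmentation monotone run F∋∅ Y Y∈F Y≢EF (⊆-min Y)
    where
    F∋∅ : InF F ∅
    F∋∅ = ∅∈F F accessible nonempty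

module _ {n : ℕ} (X : Subset n) (x : Fin n) where

  towards : Linkage n
  towards e S = if lookup X e ∨ lookup S x then 0ℚ else 1ℚ

  towards-≡0 : ∀ e S → e ∈ X ⊎ x ∈ S → towards e S ≡ 0ℚ
  towards-≡0 e S (inj₁ e∈X) rewrite []=⇒lookup e∈X = refl
  towards-≡0 e S (inj₂ x∈S) rewrite []=⇒lookup x∈S | ∨-zeroʳ (lookup X e) = refl

  towards-≡1 : ∀ {e S} → e ∉ X → x ∉ S → towards e S ≡ 1ℚ
  towards-≡1 e∉X x∉S rewrite ∉⇒lookup≡false e∉X | ∉⇒lookup≡false x∉S = refl

  towards-≤1 : ∀ e S → towards e S ≤ 1ℚ
  towards-≤1 e S with lookup X e ∨ lookup S x
  ... | true  = from-yes (0ℚ ≤? 1ℚ)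
  ... | false = ≤-refl

  towards-monotone : Monotone towards
  towards-monotone e S T S⊆T with e ∈? X | x ∈? S
  ... | yes e∈X | _       =
    ≤-reflexive (trans (towards-≡0 e T (inj₁ e∈X)) (sym (towards-≡0 e S (inj₁ e∈X))))
  ... | no _    | yes x∈S =
    ≤-reflexive (trans (towards-≡0 e T (inj₂ (S⊆T x∈S))) (sym (towards-≡0 e S (inj₂ x∈S))))
  ... | no e∉X  | no x∉S  = subst (towards e T ≤_) (sym (towards-≡1 e∉X x∉S)) (towards-≤1 e T)

  towards-≤0⇒∈ : ∀ {e S} → x ∉ S → towards e S ≤ 0ℚ → e ∈ X
  towards-≤0⇒∈ {e} x∉S cost≤0 with e ∈? X
  ... | yes e∈X = e∈X
  ... | no e∉X  = ⊥-elim (1≰0 (subst (_≤ 0ℚ) (towards-≡1 e∉X x∉S) cost≤0))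

module _ {n : ℕ} {F : SetSystem n} {EF : Subset n} (EF-union : IsUnionOfFamily F EF)
         (accessible : Accessible F) (nonempty : NonemptyFamily F)
         (chainOptimal : ∀ π → Monotone π → ChainAlgorithmOptimal F π EF) where

  AugmentsFrom : Subset n → Set
  AugmentsFrom X = ∀ Y → InF F Y → X ⊈ Y → ∃[ z ] (z ∈ X × z ∈ Γ F Y)

  module _ {X x} (X∈F : InF F X) (x∈X : x ∈ X) (augments : AugmentsFrom (X - x)) where

    private
      π : Linkage n
      π = towards X x

    Γ-meets : ∀ {S} → InF F S → S ⊆ X → x ∉ S → ∃[ z ] (z ∈ X × z ∈ Γ F S)
    Γ-meets {S} S∈F S⊆X x∉S with X - x ⊆? S
    ... | no X-x⊈S with augments S S∈F X-x⊈S
    ...   | z , z∈X-x , z∈ΓS = z , p─q⊆p X ⁅ x ⁆ z∈X-x , z∈ΓS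
    Γ-meets {S} S∈F S⊆X x∉S | yes X-x⊆S = x , x∈X , ∈Γ⁺ F x∉S (subst (InF F) (sym S∪x≡X) X∈F)
      where
      S∪x≡X : S ∪ ⁅ x ⁆ ≡ X
      S∪x≡X = ⊆-antisym (∪⁅⁆-least S⊆X x∈X) (p-x⊆q⇒p⊆q∪⁅x⁆ X-x⊆S)

    Inside : Subset n → Set
    Inside S = InF F S × (S ⊆ X ⊎ x ∈ S)

    greedyChoice-cheap : ∀ {S e} → Inside S → IsGreedyChoice F π S e → π e S ≤ 0ℚ
    greedyChoice-cheap {S} {e} (_ , inj₂ x∈S) _ = ≤-reflexive (towards-≡0 X x e S (inj₂ x∈S))
    greedyChoice-cheap {S} {e} (S∈F , inj₁ S⊆X) (_ , e-min) with x ∈? S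
    ... | yes x∈S = ≤-reflexive (towards-≡0 X x e S (inj₂ x∈S))
    ... | no x∉S with Γ-meets S∈F S⊆X x∉S
    ...   | z , z∈X , z∈ΓS = ≤-trans (e-min z z∈ΓS) (≤-reflexive (towards-≡0 X x z S (inj₁ z∈X)))

    greedyChoice-stays : ∀ {S e} → Inside S → IsGreedyChoice F π S e → S ∪ ⁅ e ⁆ ⊆ X ⊎ x ∈ S ∪ ⁅ e ⁆
    greedyChoice-stays (_ , inj₂ x∈S) _ = inj₂ (x∈p∪q⁺ (inj₁ x∈S))
    greedyChoice-stays {S} inside@(_ , inj₁ S⊆X) greedy with x ∈? S
    ... | yes x∈S = inj₂ (x∈p∪q⁺ (inj₁ x∈S))
    ... | no x∉S  = inj₁ (∪⁅⁆-least S⊆X (towards-≤0⇒∈ X x x∉S (greedyChoice-cheap inside greedy)))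

    greedyChoice-inside : ∀ {S e} → Inside S → IsGreedyChoice F π S e → Inside (S ∪ ⁅ e ⁆)
    greedyChoice-inside inside greedy@(e∈ΓS , _) =
      proj₂ (∈Γ⁻ F e∈ΓS) , greedyChoice-stays inside greedy

    FΓ≤0 : ∀ {S y} → y ∈ Γ F S → π y S ≤ 0ℚ → FΓ F π S ≤∞ fin 0ℚ
    FΓ≤0 y∈ΓS cost≤0 = ≤∞-trans (FΓ≤π F π y∈ΓS) (fin≤fin cost≤0)

    chainRun-FΓ≤0 : ∀ {R} → ChainRun F π ∅ ∅ R → FΓ F π R ≤∞ fin 0ℚ
    chainRun-FΓ≤0 run =
      chainRun-induction F π Inside (λ S → FΓ F π S ≤∞ fin 0ℚ)
        (λ inside greedy → greedyChoice-inside inside greedy ,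
                           FΓ≤0 (proj₁ greedy) (greedyChoice-cheap inside greedy))
        run (F∋∅ , inj₁ (⊆-min X)) FΓ[∅]≤0
      where
      F∋∅ : InF F ∅
      F∋∅ = ∅∈F F accessible nonempty
      FΓ[∅]≤0 : FΓ F π ∅ ≤∞ fin 0ℚ
      FΓ[∅]≤0 with Γ-meets F∋∅ (⊆-min X) ∉⊥
      ... | z , z∈X , z∈Γ∅ = FΓ≤0 z∈Γ∅ (≤-reflexive (towards-≡0 X x z ∅ (inj₁ z∈X)))

    FΓ≤0-below-EF : ∀ {Y} → InF F Y → Y ≢ EF → FΓ F π Y ≤∞ fin 0ℚ
    FΓ≤0-below-EF Y∈F Y≢EF with chainRun-exists F π ∅ ∅
    ... | R , run = ≤∞-trans (proj₂ (chainOptimal π (towards-monotone X x) R run) _ Y∈F Y≢EF)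
                             (chainRun-FΓ≤0 run)

    augmentsFrom-x∉ : ∀ {Y} → InF F Y → x ∉ Y → ∃[ z ] (z ∈ X × z ∈ Γ F Y)
    augmentsFrom-x∉ {Y} Y∈F x∉Y with any? (λ z → z ∈? X ×-dec z ∈? Γ F Y)
    ... | yes augmenting = augmenting
    ... | no none =
      ⊥-elim (1≰0 (fin-≤∞⁻ (≤∞-trans (FΓ-greatest F π 1ℚ cost-1) (FΓ≤0-below-EF Y∈F Y≢EF))))
      where
      cost-1 : ∀ y → y ∈ Γ F Y → 1ℚ ≤ π y Y
      cost-1 y y∈ΓY = ≤-reflexive (sym (towards-≡1 X x (λ y∈X → none (y , y∈X , y∈ΓY)) x∉Y))
      Y≢EF : Y ≢ EF
      Y≢EF refl = x∉Y (⊆EF F EF-union X∈F x∈X)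

    augmentsFrom-extend : AugmentsFrom X
    augmentsFrom-extend Y Y∈F X⊈Y with x ∈? Y
    ... | no x∉Y = augmentsFrom-x∉ Y∈F x∉Y
    ... | yes x∈Y with augments Y Y∈F X-x⊈Y
      where
      X-x⊈Y : X - x ⊈ Y
      X-x⊈Y X-x⊆Y = X⊈Y (⊆-trans (p-x⊆q⇒p⊆q∪⁅x⁆ X-x⊆Y) (∪⁅⁆-least ⊆-refl x∈Y))
    ...   | z , z∈X-x , z∈ΓY = z , p─q⊆p X ⁅ x ⁆ z∈X-x , z∈ΓY

  augmentsFrom : ∀ X → InF F X → AugmentsFrom X
  augmentsFrom = accessible-induction F accessible AugmentsFrom
    (λ X _ empty Y _ X⊈Y → ⊥-elim (X⊈Y (subst (_⊆ Y) (sym (Empty-unique empty)) (⊆-min Y))))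
    (λ _ _ X∈F x∈X → augmentsFrom-extend X∈F x∈X)

  chainOptimal⇒augmentation : Augmentation F
  chainOptimal⇒augmentation X Y X∈F Y∈F X⊈Y with augmentsFrom X X∈F Y Y∈F X⊈Y
  ... | z , z∈X , z∈ΓY = z , z∈X , ∈Γ⁻ F z∈ΓY

theorem3 : ∀ {n : ℕ} (F : SetSystem n) →
    Accessible F →
    NonemptyFamily F →
    (EF : Subset n) → IsUnionOfFamily F EF →
    (∀ X → InF F X → X ≢ EF → Nonempty (Γ F X)) →
    (IsAntimatroid F ⇔
      (∀ (π : Linkage n) → Monotone π → ChainAlgorithmOptimal F π EF))
theorem3 F accessible nonempty EF EF-union Γ-nonempty = mk⇔
  (antimatroid⇒chainOptimal EF-union Γ-nonempty)
  (λ chainOptimal → nonempty , accessible ,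
                    chainOptimal⇒augmentation EF-union accessible nonempty chainOptimal)
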